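{- Let $n\ge 1$, let $\gamma\subseteq\delta$ be weak compositions with $n$ parts, and let $Y$ be a semistandard skyline filling of shape $\delta/\gamma$ with entries in $[n]=\{1,\dots,n\}$ and basement $(b_1,\dots,b_n)$, where $b_k>n$ for all $1\le k\le n$. Then $Y$ is contre-lattice if and only if $Y$ is loosely contre-lattice.
   Context: Skyline diagrams. For a weak composition $\delta=(\delta_1,\dots,\delta_n)$ (nonnegative integers) the skyline diagram of shape $\delta$ has rows $1,\dots,n$ numbered from top to bottom, row $i$ consisting of cells $(i,1),\dots,(i,\delta_i)$ (left-justified), together with a basement column $0$ whose cell $(i,0)$ contains a fixed positive integer $b_i$. If $\gamma\subseteq\delta$ (i.e. $\gamma_i\le\delta_i$ for all $i$), the skew diagram $\delta/\gamma$ is obtained by additionally regarding the cells $(i,k)$, $1\le k\le\gamma_i$, as part of the basement, each containing the value $b_i$. A filling assigns a positive integer to each non-basement cell $(i,k)$, $\gamma_i<k\le\delta_i$. Triples. A type A triple is a triple of cells $(a,b,c)=((i,k),(j,k),(i,k-1))$ of the diagram (basement cells allowed) with $i<j$, $k\ge1$ and $\delta_i\ge\delta_j$. A type B triple is $(a,b,c)=((j,k+1),(i,k),(j,k))$ with $i<j$, $k\ge 0$ and $\delta_i<\delta_j$. Writing $a,b,c$ also for the values in these cells, a triple is an inversion triple if $b<a\le c$ or $a\le c<b$; otherwise it is a coinversion triple. A semistandard skyline filling (SSK) is a filling such that (i) each row, including its basement cells, is weakly decreasing from left to right, and (ii) every triple (including those involving basement cells) is an inversion triple. Column reading order reads the non-basement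 cells from top to bottom within each column, starting with the rightmost column and moving leftwards; the resulting sequence of entries is the column word $\mathrm{colword}(Y)$. A word $w_1w_2\cdots w_m$ with maximum letter $r$ is contre-lattice if in every initial segment $w_1\cdots w_i$, for each $1<j\le r$, the number of occurrences of $j$ is at least the number of occurrences of $j-1$. $Y$ is contre-lattice if $\mathrm{colword}(Y)$ is contre-lattice. If $Y$ has $t$ columns, let $C_k$ ($1\le k\le t$) be the set of non-basement entries in column $k$ (the column sets of $Y$); sort each $C_k$ in decreasing order and form the word $w_Y=C_tC_{t-1}\cdots C_1$. $Y$ is loosely contre-lattice if $w_Y$ is contre-lattice. -}

module Defs where

open import Data.Nat using (ℕ; zero; suc; _≤_; _<_; _≤ᵇ_; _<ᵇ_; _∸_; _⊔_; _≟_)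
open import Data.Fin as F using (Fin; toℕ)
open import Data.List using (List; []; _∷_; concatMap; map; downFrom; allFin; filter; take; length; foldr; deduplicate; reverse)
open import Data.Bool using (Bool; true; false; if_then_else_; _∧_)
open import Data.Product using (_×_)
open import Data.Sum using (_⊎_)
open import Relation.Binary.PropositionalEquality using (_≡_)

-- Weak compositions with n parts: row i (top to bottom) ↦ δ i, rows indexed by Fin n
-- (Fin index 0 is row 1).
Comp : ℕ → Set
Comp n = Fin n → ℕ

_⊆ᶜ_ : ∀ {n} → Comp n → Comp n → Set
γ ⊆ᶜ δ = ∀ i → γ i ≤ δ i

-- A filling: value at cell (i,k); only the non-basement cells γ i < k ≤ δ i matter.
Filling : ℕ → Set
Filling n = Fin n → ℕ → ℕ

-- Value of a cell (i,k) of δ/γ with basement b: basement cells (k ≤ γ i, including k = 0)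
-- hold b i, the others hold Y i k.
val : ∀ {n} → Comp n → (Fin n → ℕ) → Filling n → Fin n → ℕ → ℕ
val γ b Y i k = if k ≤ᵇ γ i then b i else Y i k

EntriesIn : ∀ {n} → ℕ → Comp n → Comp n → Filling n → Set
EntriesIn {n} m δ γ Y = ∀ (i : Fin n) (k : ℕ) → γ i < k → k ≤ δ i → 1 ≤ Y i k × Y i k ≤ m

InversionTriple : ℕ → ℕ → ℕ → Set
InversionTriple a b c = (b < a × a ≤ c) ⊎ (a ≤ c × c < b)

module _ {n : ℕ} (δ γ : Comp n) (b : Fin n → ℕ) (Y : Filling n) where
  private v = val γ b Y

  RowsDecreasing : Set
  RowsDecreasing = ∀ (i : Fin n) (k : ℕ) → 1 ≤ k → k ≤ δ i → v i k ≤ v i (k ∸ 1)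

  TypeAInv : Set
  TypeAInv = ∀ (i j : Fin n) (k : ℕ) → i F.< j → 1 ≤ k → δ j ≤ δ i → k ≤ δ j →
             InversionTriple (v i k) (v j k) (v i (k ∸ 1))

  TypeBInv : Set
  TypeBInv = ∀ (i j : Fin n) (k : ℕ) → i F.< j → δ i < δ j → suc k ≤ δ j → k ≤ δ i →
             InversionTriple (v j (suc k)) (v i k) (v j k)

  IsSSK : Set
  IsSSK = RowsDecreasing × TypeAInv × TypeBInv

  numCols : ℕ
  numCols = foldr _⊔_ 0 (map δ (allFin n))

  column : ℕ → List ℕ
  column k = concatMap (λ i → if (γ i <ᵇ k) ∧ (k ≤ᵇ δ i) then Y i k ∷ [] else []) (allFin n)

  colword : List ℕ
  colword = concatMap column (map suc (downFrom numCols))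

insertDec : ℕ → List ℕ → List ℕ
insertDec x [] = x ∷ []
insertDec x (y ∷ ys) = if y ≤ᵇ x then x ∷ y ∷ ys else y ∷ insertDec x ys

sortDec : List ℕ → List ℕ
sortDec = foldr insertDec []

module _ {n : ℕ} (δ γ : Comp n) (b : Fin n → ℕ) (Y : Filling n) where
  columnSet : ℕ → List ℕ
  columnSet k = sortDec (deduplicate _≟_ (column δ γ b Y k))

  looseWord : List ℕ
  looseWord = concatMap columnSet (map suc (downFrom (numCols δ γ b Y)))

maxList : List ℕ → ℕ
maxList = foldr _⊔_ 0

ContreLattice : List ℕ → Set
ContreLattice w = ∀ (p j : ℕ) → p ≤ length w → 2 ≤ j → j ≤ maxList w →
  length (filter (_≟ (j ∸ 1)) (take p w)) ≤ length (filter (_≟ j) (take p w))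

IsContreLattice : ∀ {n} → Comp n → Comp n → (Fin n → ℕ) → Filling n → Set
IsContreLattice δ γ b Y = ContreLattice (colword δ γ b Y)

IsLooselyContreLattice : ∀ {n} → Comp n → Comp n → (Fin n → ℕ) → Filling n → Set
IsLooselyContreLattice δ γ b Y = ContreLattice (looseWord δ γ b Y)

-- SSK columns have distinct entries, so the loose word is the column word with every column
-- sorted decreasingly. Both words therefore have the same maximal letter and the same letter
-- counts at every column boundary. Inside a column of distinct letters the contre-lattice
-- inequality for (j - 1, j) can only fail on a prefix that contains j - 1 but not a later j,
-- and then only if the columns to the right contain no more j than j - 1. A decreasingly
-- sorted column never has j - 1 before j. In a skyline column, an m above an m + 1 with such a
-- tie to the right is impossible: the type A triple rule copies the m one column to the left,
-- the type B rule copies the m + 1 one column to the right, and counting then forces a new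
-- such pair with a tie there. A leftward chain is stopped by the basement (whose values
-- exceed n), a rightward one by the last column.
module Submission where

open import Defs
open import Data.Nat using (ℕ; zero; suc; _+_; _∸_; _≤_; _<_; _>_; _≟_; _≤ᵇ_; _<ᵇ_; z≤n; s≤s; _≤?_; _<?_)
open import Data.Nat.Properties
open import Data.Fin as Fin using (Fin; zero; suc; toℕ)
import Data.Fin.Properties as Finₚ
open import Data.List
  using (List; []; _∷_; [_]; _++_; length; filter; take; drop; map; concatMap; downFrom; tabulate; allFin; deduplicate)
open import Data.List.Properties
  using (filter-++; length-++; filter-accept; filter-reject; filter-all; take++drop≡id; ++-assoc; ++-identityʳ)
open import Data.List.Relation.Unary.All as All using (All; []; _∷_)
open import Data.List.Relation.Unary.Any using (here; there)
open import Data.List.Relation.Unary.AllPairs using (AllPairs; []; _∷_)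
open import Data.List.Membership.Propositional using (_∈_)
open import Data.List.Membership.Propositional.Properties using (∈-map⁺; ∈-allFin)
open import Data.List.Relation.Binary.Permutation.Propositional using (_↭_; prep; swap; ↭-refl; ↭-trans; ↭-sym)
open import Data.List.Relation.Binary.Permutation.Propositional.Properties using (↭-length; filter-↭; All-resp-↭)
open import Data.Bool using (Bool; true; false; T; _∧_; if_then_else_)
open import Data.Bool.Properties using (T-∧)
open import Data.Unit using (tt)
open import Data.Product using (Σ; _×_; _,_; proj₁; proj₂)
open import Data.Sum using (inj₁; inj₂)
open import Data.Empty using (⊥; ⊥-elim)
open import Function using (_∘_)
open import Function.Bundles using (Equivalence; _⇔_; mk⇔)
open import Relation.Nullary using (¬_; yes; no; ¬?; contradiction)
open import Relation.Nullary.Reflects using (ofʸ; ofⁿ)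
open import Relation.Binary.PropositionalEquality hiding ([_])

count : ℕ → List ℕ → ℕ
count x w = length (filter (_≟ x) w)

count-++ : ∀ x u w → count x (u ++ w) ≡ count x u + count x w
count-++ x u w = trans (cong length (filter-++ (_≟ x) u w)) (length-++ (filter (_≟ x) u))

count-∷-≡ : ∀ x w → count x (x ∷ w) ≡ suc (count x w)
count-∷-≡ x w = cong length (filter-accept (_≟ x) refl)

count-∷-≢ : ∀ {x y} w → y ≢ x → count x (y ∷ w) ≡ count x w
count-∷-≢ w y≢x = cong length (filter-reject (_≟ _) y≢x)

count-tail-≤ : ∀ x y w → count x w ≤ count x (y ∷ w)
count-tail-≤ x y w = subst (count x w ≤_) (sym (count-++ x [ y ] w)) (m≤n+m (count x w) (count x [ y ]))

count-take-drop : ∀ x p w → count x w ≡ count x (take p w) + count x (drop p w)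
count-take-drop x p w = trans (cong (count x) (sym (take++drop≡id p w))) (count-++ x (take p w) (drop p w))

count-take-≤ : ∀ x p w → count x (take p w) ≤ count x w
count-take-≤ x p w = subst (count x (take p w) ≤_) (sym (count-take-drop x p w)) (m≤m+n _ (count x (drop p w)))

count-drop-≤ : ∀ x p w → count x (drop p w) ≤ count x w
count-drop-≤ x p w = subst (count x (drop p w) ≤_) (sym (count-take-drop x p w)) (m≤n+m _ (count x (take p w)))

count-↭ : ∀ x {u w} → u ↭ w → count x u ≡ count x w
count-↭ x u↭w = ↭-length (filter-↭ (_≟ x) u↭w)

occurs⇒∈ : ∀ x w → 1 ≤ count x w → x ∈ w
occurs⇒∈ x (y ∷ w) occ with y ≟ x
... | yes refl = here refl
... | no y≢x = there (occurs⇒∈ x w (subst (1 ≤_) (count-∷-≢ w y≢x) occ))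

absent⇒All≢ : ∀ x w → count x w ≡ 0 → All (x ≢_) w
absent⇒All≢ x [] _ = []
absent⇒All≢ x (y ∷ w) x∉w with y ≟ x
... | yes refl = contradiction (trans (sym (count-∷-≡ y w)) x∉w) λ ()
... | no y≢x = (y≢x ∘ sym) ∷ absent⇒All≢ x w (trans (sym (count-∷-≢ w y≢x)) x∉w)

∈⇒≤maxList : ∀ {x} xs → x ∈ xs → x ≤ maxList xs
∈⇒≤maxList (y ∷ xs) (here refl) = m≤m⊔n y (maxList xs)
∈⇒≤maxList (y ∷ xs) (there x∈xs) = ≤-trans (∈⇒≤maxList xs x∈xs) (m≤n⊔m y (maxList xs))

maxList-mono : ∀ u w → (∀ x → 1 ≤ count x u → 1 ≤ count x w) → maxList u ≤ maxList w
maxList-mono [] w occ = z≤n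
maxList-mono (y ∷ u) w occ = ⊔-lub
  (∈⇒≤maxList w (occurs⇒∈ y w (occ y (subst (1 ≤_) (sym (count-∷-≡ y u)) (s≤s z≤n)))))
  (maxList-mono u w (λ x x∈u → occ x (≤-trans x∈u (count-tail-≤ x y u))))

maxList-cong : ∀ u w → (∀ x → count x u ≡ count x w) → maxList u ≡ maxList w
maxList-cong u w same = ≤-antisym
  (maxList-mono u w (λ x → subst (1 ≤_) (same x)))
  (maxList-mono w u (λ x → subst (1 ≤_) (sym (same x))))

Distinct : List ℕ → Set
Distinct s = ∀ x → count x s ≤ 1

distinct-head : ∀ x w → Distinct (x ∷ w) → count x w ≡ 0
distinct-head x w distinct = n<1⇒n≡0 (subst (_≤ 1) (count-∷-≡ x w) (distinct x))

distinct-tail : ∀ x w → Distinct (x ∷ w) → Distinct w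
distinct-tail x w distinct z = ≤-trans (count-tail-≤ z x w) (distinct z)

Precedes : ℕ → ℕ → List ℕ → Set
Precedes a b s = Σ ℕ λ p → 1 ≤ count a (take p s) × 1 ≤ count b (drop p s)

two-occurrences⇒precedes : ∀ x w → 2 ≤ count x w → Precedes x x w
two-occurrences⇒precedes x (y ∷ w) two with y ≟ x
... | yes refl = 1 , subst (1 ≤_) (sym (count-∷-≡ y [])) ≤-refl , ≤-pred (subst (2 ≤_) (count-∷-≡ y w) two)
... | no y≢x with two-occurrences⇒precedes x w (subst (2 ≤_) (count-∷-≢ w y≢x) two)
...   | p , x∈pre , x∈post = suc p , subst (1 ≤_) (sym (count-∷-≢ (take p w) y≢x)) x∈pre , x∈post

-- Contre-lattice prefixes

IncreasingUpTo : ℕ → (ℕ → ℕ) → Set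
IncreasingUpTo R c = ∀ j → 2 ≤ j → j ≤ R → c (j ∸ 1) ≤ c j

infixl 6 _⊕_
_⊕_ : (ℕ → ℕ) → List ℕ → ℕ → ℕ
(c ⊕ w) x = c x + count x w

⊕-[] : ∀ c x → (c ⊕ []) x ≡ c x
⊕-[] c x = +-identityʳ (c x)

⊕-++ : ∀ c u w x → (c ⊕ (u ++ w)) x ≡ (c ⊕ u ⊕ w) x
⊕-++ c u w x = trans (cong (c x +_) (count-++ x u w)) (sym (+-assoc (c x) (count x u) (count x w)))

-- c holds the letter counts of what was read before w.
PrefixesIncreasing : ℕ → (ℕ → ℕ) → List ℕ → Set
PrefixesIncreasing R c w = ∀ p → p ≤ length w → IncreasingUpTo R (c ⊕ take p w)

contreLattice⇒prefixesIncreasing : ∀ w → ContreLattice w → PrefixesIncreasing (maxList w) (λ _ → 0) w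
contreLattice⇒prefixesIncreasing w cl p p≤ j 2≤j j≤R = cl p j p≤ 2≤j j≤R

prefixesIncreasing⇒contreLattice : ∀ w → PrefixesIncreasing (maxList w) (λ _ → 0) w → ContreLattice w
prefixesIncreasing⇒contreLattice w inc p j p≤ 2≤j j≤R = inc p p≤ j 2≤j j≤R

module _ {R : ℕ} where

  increasing-cong : ∀ {c d} → (∀ x → c x ≡ d x) → IncreasingUpTo R c → IncreasingUpTo R d
  increasing-cong c≗d inc j 2≤j j≤R = subst₂ _≤_ (c≗d (j ∸ 1)) (c≗d j) (inc j 2≤j j≤R)

  prefixes-cong : ∀ {c d} w → (∀ x → c x ≡ d x) → PrefixesIncreasing R c w → PrefixesIncreasing R d w
  prefixes-cong w c≗d inc p p≤ = increasing-cong (λ x → cong (_+ count x (take p w)) (c≗d x)) (inc p p≤)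

  prefixes-head : ∀ {c} w → PrefixesIncreasing R c w → IncreasingUpTo R c
  prefixes-head {c} w inc = increasing-cong (⊕-[] c) (inc 0 z≤n)

  prefixes-[] : ∀ {c} → IncreasingUpTo R c → PrefixesIncreasing R c []
  prefixes-[] {c} inc zero z≤n = increasing-cong (λ x → sym (⊕-[] c x)) inc

  prefixes-∷⁻ : ∀ {c} y w → PrefixesIncreasing R c (y ∷ w) → PrefixesIncreasing R (c ⊕ [ y ]) w
  prefixes-∷⁻ {c} y w inc p p≤ = increasing-cong (⊕-++ c [ y ] (take p w)) (inc (suc p) (s≤s p≤))

  prefixes-++⁻ : ∀ {c} u w → PrefixesIncreasing R c (u ++ w) → PrefixesIncreasing R (c ⊕ u) w
  prefixes-++⁻ {c} [] w inc = prefixes-cong w (λ x → sym (⊕-[] c x)) inc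
  prefixes-++⁻ {c} (y ∷ u) w inc =
    prefixes-cong w (λ x → sym (⊕-++ c [ y ] u x)) (prefixes-++⁻ u w (prefixes-∷⁻ y (u ++ w) inc))

  prefixes-++⁺ : ∀ {c} u w → PrefixesIncreasing R c u → PrefixesIncreasing R (c ⊕ u) w →
                 PrefixesIncreasing R c (u ++ w)
  prefixes-++⁺ {c} [] w _ incw = prefixes-cong w (⊕-[] c) incw
  prefixes-++⁺ {c} (y ∷ u) w incu incw zero _ = incu zero z≤n
  prefixes-++⁺ {c} (y ∷ u) w incu incw (suc p) (s≤s p≤) =
    increasing-cong (λ x → sym (⊕-++ c [ y ] (take p (u ++ w)) x))
      (prefixes-++⁺ u w (prefixes-∷⁻ y u incu) (prefixes-cong w (⊕-++ c [ y ] u) incw) p p≤)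

AscentsStrict : ℕ → (ℕ → ℕ) → List ℕ → Set
AscentsStrict R c s = ∀ j → 2 ≤ j → j ≤ R → Precedes (j ∸ 1) j s → c (j ∸ 1) < c j

distinct-prefixesIncreasing : ∀ {R c} s → Distinct s → IncreasingUpTo R c → IncreasingUpTo R (c ⊕ s) →
                              AscentsStrict R c s → PrefixesIncreasing R c s
distinct-prefixesIncreasing {c = c} s distinct inc inc⊕s ascents p _ j 2≤j j≤R
  with 1 ≤? count j (take p s) | 1 ≤? count j (drop p s) | 1 ≤? count (j ∸ 1) (take p s)
... | yes j∈pre | _ | _ =
  +-mono-≤ (inc j 2≤j j≤R) (≤-trans (≤-trans (count-take-≤ (j ∸ 1) p s) (distinct (j ∸ 1))) j∈pre)
... | no _ | yes j∈post | yes i∈pre = begin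
  c (j ∸ 1) + count (j ∸ 1) (take p s)
    ≤⟨ +-monoʳ-≤ (c (j ∸ 1)) (≤-trans (count-take-≤ (j ∸ 1) p s) (distinct (j ∸ 1))) ⟩
  c (j ∸ 1) + 1                        ≡⟨ +-comm (c (j ∸ 1)) 1 ⟩
  suc (c (j ∸ 1))                      ≤⟨ ascents j 2≤j j≤R (p , i∈pre , j∈post) ⟩
  c j                                  ≤⟨ m≤m+n (c j) _ ⟩
  c j + count j (take p s)             ∎
  where open ≤-Reasoning
... | no _ | yes _ | no i∉pre = begin
  c (j ∸ 1) + count (j ∸ 1) (take p s) ≡⟨ cong (c (j ∸ 1) +_) (n<1⇒n≡0 (≰⇒> i∉pre)) ⟩
  c (j ∸ 1) + 0                        ≡⟨ +-identityʳ (c (j ∸ 1)) ⟩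
  c (j ∸ 1)                            ≤⟨ inc j 2≤j j≤R ⟩
  c j                                  ≤⟨ m≤m+n (c j) _ ⟩
  c j + count j (take p s)             ∎
  where open ≤-Reasoning
... | no j∉pre | no j∉post | _ = begin
  c (j ∸ 1) + count (j ∸ 1) (take p s) ≤⟨ +-monoʳ-≤ (c (j ∸ 1)) (count-take-≤ (j ∸ 1) p s) ⟩
  c (j ∸ 1) + count (j ∸ 1) s          ≤⟨ inc⊕s j 2≤j j≤R ⟩
  c j + count j s                      ≡⟨ cong (c j +_) j∉s ⟩
  c j + 0                              ≤⟨ +-monoʳ-≤ (c j) z≤n ⟩
  c j + count j (take p s)             ∎
  where open ≤-Reasoning
        j∉s = trans (count-take-drop j p s) (cong₂ _+_ (n<1⇒n≡0 (≰⇒> j∉pre)) (n<1⇒n≡0 (≰⇒> j∉post)))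

StrictlyDecreasing : List ℕ → Set
StrictlyDecreasing = AllPairs _>_

decreasing-precedes : ∀ {a b} s → StrictlyDecreasing s → Precedes a b s → b < a
decreasing-precedes [] _ (zero , () , _)
decreasing-precedes [] _ (suc p , () , _)
decreasing-precedes (y ∷ s) _ (zero , () , _)
decreasing-precedes {a} {b} (y ∷ s) (y>s ∷ s↓) (suc p , a∈pre , b∈post) with y ≟ a
... | yes refl = All.lookup y>s (occurs⇒∈ b s (≤-trans b∈post (count-drop-≤ b p s)))
... | no y≢a = decreasing-precedes s s↓ (p , subst (1 ≤_) (count-∷-≢ (take p s) y≢a) a∈pre , b∈post)

decreasing-ascentsStrict : ∀ {R c} s → StrictlyDecreasing s → AscentsStrict R c s
decreasing-ascentsStrict s s↓ j _ _ prec = contradiction (decreasing-precedes s s↓ prec) (≤⇒≯ (m∸n≤m j 1))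

deduplicate-distinct : ∀ w → Distinct w → deduplicate _≟_ w ≡ w
deduplicate-distinct [] _ = refl
deduplicate-distinct (x ∷ w) distinct = cong (x ∷_) (begin
  filter (¬? ∘ (x ≟_)) (deduplicate _≟_ w)
    ≡⟨ cong (filter (¬? ∘ (x ≟_))) (deduplicate-distinct w (distinct-tail x w distinct)) ⟩
  filter (¬? ∘ (x ≟_)) w
    ≡⟨ filter-all (¬? ∘ (x ≟_)) (absent⇒All≢ x w (distinct-head x w distinct)) ⟩
  w ∎)
  where open ≡-Reasoning

insertDec-↭ : ∀ x ys → insertDec x ys ↭ x ∷ ys
insertDec-↭ x [] = ↭-refl
insertDec-↭ x (y ∷ ys) with y ≤ᵇ x
... | true = ↭-refl
... | false = ↭-trans (prep y (insertDec-↭ x ys)) (swap y x ↭-refl)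

sortDec-↭ : ∀ w → sortDec w ↭ w
sortDec-↭ [] = ↭-refl
sortDec-↭ (x ∷ w) = ↭-trans (insertDec-↭ x (sortDec w)) (prep x (sortDec-↭ w))

insertDec-decreasing : ∀ x ys → count x ys ≡ 0 → StrictlyDecreasing ys → StrictlyDecreasing (insertDec x ys)
insertDec-decreasing x [] _ [] = [] ∷ []
insertDec-decreasing x (y ∷ ys) x∉ys (y>ys ∷ ys↓) with y ≤ᵇ x | ≤ᵇ-reflects-≤ y x
... | true | ofʸ y≤x = (y<x ∷ All.map (λ z<y → <-trans z<y y<x) y>ys) ∷ y>ys ∷ ys↓
  where y<x = ≤∧≢⇒< y≤x (All.head (absent⇒All≢ x (y ∷ ys) x∉ys) ∘ sym)
... | false | ofⁿ y≰x = All-resp-↭ (↭-sym (insertDec-↭ x ys)) (≰⇒> y≰x ∷ y>ys)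
                      ∷ insertDec-decreasing x ys (trans (sym (count-∷-≢ ys (y≰x ∘ ≤-reflexive))) x∉ys) ys↓

sortDec-decreasing : ∀ w → Distinct w → StrictlyDecreasing (sortDec w)
sortDec-decreasing [] _ = []
sortDec-decreasing (x ∷ w) distinct = insertDec-decreasing x (sortDec w)
  (trans (count-↭ x (sortDec-↭ w)) (distinct-head x w distinct))
  (sortDec-decreasing w (distinct-tail x w distinct))

module _ (w : List ℕ) (distinct : Distinct w) where

  sortDec-deduplicate-↭ : sortDec (deduplicate _≟_ w) ↭ w
  sortDec-deduplicate-↭ = subst (λ u → sortDec u ↭ w) (sym (deduplicate-distinct w distinct)) (sortDec-↭ w)

  sortDec-deduplicate-decreasing : StrictlyDecreasing (sortDec (deduplicate _≟_ w))
  sortDec-deduplicate-decreasing =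
    subst (StrictlyDecreasing ∘ sortDec) (sym (deduplicate-distinct w distinct)) (sortDec-decreasing w distinct)

-- Columns lo + m, …, lo + 1 in this order; for lo = 0 this is definitionally how colword and
-- looseWord read their columns.
readColumns : (ℕ → List ℕ) → ℕ → ℕ → List ℕ
readColumns f lo m = concatMap f (map (λ d → lo + suc d) (downFrom m))

readColumns-split : ∀ f lo a c → readColumns f lo (a + c) ≡ readColumns f (lo + c) a ++ readColumns f lo c
readColumns-split f lo zero c = refl
readColumns-split f lo (suc a) c = begin
  f (lo + suc (a + c)) ++ readColumns f lo (a + c)
    ≡⟨ cong (f (lo + suc (a + c)) ++_) (readColumns-split f lo a c) ⟩
  f (lo + suc (a + c)) ++ readColumns f (lo + c) a ++ readColumns f lo c
    ≡⟨ sym (++-assoc (f (lo + suc (a + c))) _ _) ⟩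
  (f (lo + suc (a + c)) ++ readColumns f (lo + c) a) ++ readColumns f lo c
    ≡⟨ cong (λ l → (f l ++ readColumns f (lo + c) a) ++ readColumns f lo c) column-index ⟩
  (f (lo + c + suc a) ++ readColumns f (lo + c) a) ++ readColumns f lo c ∎
  where
    open ≡-Reasoning
    column-index : lo + suc (a + c) ≡ lo + c + suc a
    column-index = trans (cong (lo +_) (+-comm (suc a) c)) (sym (+-assoc lo c (suc a)))

readColumns-last : ∀ f lo a → readColumns f lo (suc a) ≡ readColumns f (suc lo) a ++ f (suc lo)
readColumns-last f lo a = begin
  readColumns f lo (suc a)                       ≡⟨ cong (readColumns f lo) (+-comm 1 a) ⟩
  readColumns f lo (a + 1)                       ≡⟨ readColumns-split f lo a 1 ⟩
  readColumns f (lo + 1) a ++ (f (lo + 1) ++ []) ≡⟨ cong (readColumns f (lo + 1) a ++_) (++-identityʳ (f (lo + 1))) ⟩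
  readColumns f (lo + 1) a ++ f (lo + 1)         ≡⟨ cong (λ l → readColumns f l a ++ f l) (+-comm lo 1) ⟩
  readColumns f (suc lo) a ++ f (suc lo)         ∎
  where open ≡-Reasoning

readColumns-count : ∀ f g → (∀ k x → count x (f k) ≡ count x (g k)) →
                    ∀ lo m x → count x (readColumns f lo m) ≡ count x (readColumns g lo m)
readColumns-count f g same lo zero x = refl
readColumns-count f g same lo (suc m) x = begin
  count x (f (lo + suc m) ++ readColumns f lo m)
    ≡⟨ count-++ x (f (lo + suc m)) _ ⟩
  count x (f (lo + suc m)) + count x (readColumns f lo m)
    ≡⟨ cong₂ _+_ (same (lo + suc m) x) (readColumns-count f g same lo m x) ⟩
  count x (g (lo + suc m)) + count x (readColumns g lo m)
    ≡⟨ sym (count-++ x (g (lo + suc m)) _) ⟩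
  count x (g (lo + suc m) ++ readColumns g lo m) ∎
  where open ≡-Reasoning

module ColumnReading (f : ℕ → List ℕ) (t : ℕ) where

  countRightOf : ℕ → ℕ → ℕ
  countRightOf k x = count x (readColumns f k (t ∸ k))

  countRightOf-step : ∀ k → k < t → ∀ x → countRightOf k x ≡ countRightOf (suc k) x + count x (f (suc k))
  countRightOf-step k k<t x = begin
    count x (readColumns f k (t ∸ k))
      ≡⟨ cong (count x ∘ readColumns f k) (+-∸-assoc 1 k<t) ⟩
    count x (readColumns f k (suc (t ∸ suc k)))
      ≡⟨ cong (count x) (readColumns-last f k (t ∸ suc k)) ⟩
    count x (readColumns f (suc k) (t ∸ suc k) ++ f (suc k))
      ≡⟨ count-++ x (readColumns f (suc k) (t ∸ suc k)) (f (suc k)) ⟩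
    count x (readColumns f (suc k) (t ∸ suc k)) + count x (f (suc k)) ∎
    where open ≡-Reasoning

  module _ {R : ℕ} where

    boundaries-increasing : PrefixesIncreasing R (λ _ → 0) (readColumns f 0 t) →
                            ∀ k → k ≤ t → IncreasingUpTo R (countRightOf k)
    boundaries-increasing inc k k≤t = prefixes-head (readColumns f 0 k)
      (prefixes-++⁻ (readColumns f k (t ∸ k)) (readColumns f 0 k)
        (subst (PrefixesIncreasing R (λ _ → 0)) word-split inc))
      where
        word-split : readColumns f 0 t ≡ readColumns f k (t ∸ k) ++ readColumns f 0 k
        word-split = trans (cong (readColumns f 0) (sym (m∸n+n≡m k≤t))) (readColumns-split f 0 (t ∸ k) k)

    prefixes-increasing : (∀ k → k ≤ t → IncreasingUpTo R (countRightOf k)) → (∀ k → Distinct (f k)) →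
                          (∀ k → k < t → AscentsStrict R (countRightOf (suc k)) (f (suc k))) →
                          PrefixesIncreasing R (λ _ → 0) (readColumns f 0 t)
    prefixes-increasing boundaries distinct ascents =
      prefixes-cong (readColumns f 0 t) nothing-right (read-up-to t ≤-refl)
      where
        nothing-right : ∀ x → countRightOf t x ≡ 0
        nothing-right x = cong (count x ∘ readColumns f t) (n∸n≡0 t)
        read-up-to : ∀ m → m ≤ t → PrefixesIncreasing R (countRightOf m) (readColumns f 0 m)
        read-up-to zero 0≤t = prefixes-[] (boundaries zero 0≤t)
        read-up-to (suc m) m<t = prefixes-++⁺ (f (suc m)) (readColumns f 0 m)
          (distinct-prefixesIncreasing (f (suc m)) (distinct (suc m)) (boundaries (suc m) m<t)
            (increasing-cong (countRightOf-step m m<t) (boundaries m (<⇒≤ m<t))) (ascents m m<t))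
          (prefixes-cong (readColumns f 0 m) (countRightOf-step m m<t) (read-up-to m (<⇒≤ m<t)))

contreLattice-transfer : ∀ f g t → (∀ k x → count x (f k) ≡ count x (g k)) → (∀ k → Distinct (g k)) →
  let open ColumnReading g t; R = maxList (readColumns g 0 t) in
  ((∀ k → k ≤ t → IncreasingUpTo R (countRightOf k)) → ∀ k → AscentsStrict R (countRightOf k) (g k)) →
  ContreLattice (readColumns f 0 t) → ContreLattice (readColumns g 0 t)
contreLattice-transfer f g t same distinct ascents cl =
  prefixesIncreasing⇒contreLattice (readColumns g 0 t)
    (G.prefixes-increasing boundaries distinct (λ k _ → ascents boundaries (suc k)))
  where
    module F = ColumnReading f t
    module G = ColumnReading g t
    same-max : maxList (readColumns f 0 t) ≡ maxList (readColumns g 0 t)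
    same-max = maxList-cong (readColumns f 0 t) (readColumns g 0 t) (readColumns-count f g same 0 t)
    boundaries : ∀ k → k ≤ t → IncreasingUpTo (maxList (readColumns g 0 t)) (G.countRightOf k)
    boundaries k k≤t = increasing-cong (readColumns-count f g same k (t ∸ k))
      (subst (λ R → IncreasingUpTo R (F.countRightOf k)) same-max
        (F.boundaries-increasing (contreLattice⇒prefixesIncreasing _ cl) k k≤t))

-- Columns as selections of rows

module Selection {N : ℕ} (c : Fin N → Bool) (y : Fin N → ℕ) where

  entry : Fin N → List ℕ
  entry i = if c i then [ y i ] else []

  selected : List ℕ
  selected = concatMap entry (allFin N)

  Selects : Fin N → ℕ → Set
  Selects i x = T (c i) × y i ≡ x

  -- Generalised over an enumeration e of rows so that induction can drop the first row.
  private
    entries : ∀ {m} → (Fin m → Fin N) → List ℕ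
    entries e = concatMap entry (tabulate e)

    occurs⁻ : ∀ {m} (e : Fin m → Fin N) x → 1 ≤ count x (entries e) → Σ (Fin m) λ i → Selects (e i) x
    occurs⁻ {suc m} e x occ with c (e zero) in ce
    ... | false with occurs⁻ (e ∘ suc) x occ
    ...   | i , sel = suc i , sel
    occurs⁻ {suc m} e x occ | true with y (e zero) ≟ x
    ...   | yes y≡x = zero , subst T (sym ce) tt , y≡x
    ...   | no y≢x with occurs⁻ (e ∘ suc) x (subst (1 ≤_) (count-∷-≢ (entries (e ∘ suc)) y≢x) occ)
    ...     | i , sel = suc i , sel

    occurs⁺ : ∀ {m} (e : Fin m → Fin N) i → T (c (e i)) → 1 ≤ count (y (e i)) (entries e)
    occurs⁺ {suc m} e zero _ with c (e zero)
    ... | true = subst (1 ≤_) (sym (count-∷-≡ (y (e zero)) (entries (e ∘ suc)))) (s≤s z≤n)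
    occurs⁺ {suc m} e (suc i) ci with c (e zero)
    ... | false = occurs⁺ (e ∘ suc) i ci
    ... | true = ≤-trans (occurs⁺ (e ∘ suc) i ci) (count-tail-≤ (y (e (suc i))) (y (e zero)) (entries (e ∘ suc)))

    precedes⁻ : ∀ {m} (e : Fin m → Fin N) a b → Precedes a b (entries e) →
                Σ (Fin m) λ i → Σ (Fin m) λ i' → i Fin.< i' × Selects (e i) a × Selects (e i') b
    precedes⁻ {zero} e a b (zero , () , _)
    precedes⁻ {zero} e a b (suc p , () , _)
    precedes⁻ {suc m} e a b prec with c (e zero) in ce
    ... | false with precedes⁻ (e ∘ suc) a b prec
    ...   | i , i' , i<i' , sa , sb = suc i , suc i' , s≤s i<i' , sa , sb
    precedes⁻ {suc m} e a b (zero , () , _) | true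
    precedes⁻ {suc m} e a b (suc p , a∈pre , b∈post) | true with y (e zero) ≟ a
    ... | yes y≡a with occurs⁻ (e ∘ suc) b (≤-trans b∈post (count-drop-≤ b p (entries (e ∘ suc))))
    ...   | i' , sb = zero , suc i' , s≤s z≤n , (subst T (sym ce) tt , y≡a) , sb
    precedes⁻ {suc m} e a b (suc p , a∈pre , b∈post) | true | no y≢a
      with precedes⁻ (e ∘ suc) a b
             (p , subst (1 ≤_) (count-∷-≢ (take p (entries (e ∘ suc))) y≢a) a∈pre , b∈post)
    ...   | i , i' , i<i' , sa , sb = suc i , suc i' , s≤s i<i' , sa , sb

  selected-occurs⁻ : ∀ x → 1 ≤ count x selected → Σ (Fin N) λ i → Selects i x
  selected-occurs⁻ = occurs⁻ (λ i → i)

  selected-occurs⁺ : ∀ i → T (c i) → 1 ≤ count (y i) selected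
  selected-occurs⁺ = occurs⁺ (λ i → i)

  selected-precedes : ∀ a b → Precedes a b selected →
                      Σ (Fin N) λ i → Σ (Fin N) λ i' → i Fin.< i' × Selects i a × Selects i' b
  selected-precedes = precedes⁻ (λ i → i)

inversion-a≢b : ∀ {a b c} → InversionTriple a b c → a ≢ b
inversion-a≢b (inj₁ (b<a , _)) refl = <-irrefl refl b<a
inversion-a≢b (inj₂ (a≤c , c<b)) refl = <-irrefl refl (≤-<-trans a≤c c<b)

inversion-b≢c : ∀ {a b c} → InversionTriple a b c → b ≢ c
inversion-b≢c (inj₁ (b<a , a≤c)) refl = <-irrefl refl (<-≤-trans b<a a≤c)
inversion-b≢c (inj₂ (_ , c<b)) refl = <-irrefl refl c<b

inversion-ascent : ∀ {m c} → InversionTriple m (suc m) c → c ≡ m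
inversion-ascent (inj₁ (m+1<m , _)) = contradiction m+1<m (<-asym (n<1+n _))
inversion-ascent (inj₂ (m≤c , c<m+1)) = ≤-antisym (≤-pred c<m+1) m≤c

inversion-descent : ∀ {a m} → InversionTriple a m (suc m) → a ≡ suc m
inversion-descent (inj₁ (m<a , a≤m+1)) = ≤-antisym a≤m+1 m<a
inversion-descent (inj₂ (_ , m+1<m)) = contradiction m+1<m (<-asym (n<1+n _))

-- Semistandard skyline fillings

module Skyline {n : ℕ} (δ γ : Comp n) (b : Fin n → ℕ) (Y : Filling n)
               (ssk : IsSSK δ γ b Y) (bounded : EntriesIn n δ γ Y) (basement-large : ∀ i → n < b i) where

  private
    v = val γ b Y
    typeA = proj₁ (proj₂ ssk)
    typeB = proj₂ (proj₂ ssk)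

  Cell : Fin n → ℕ → Set
  Cell i k = γ i < k × k ≤ δ i

  Entry : ℕ → Fin n → ℕ → Set
  Entry k i x = Cell i k × Y i k ≡ x

  val-cell : ∀ {i k} → γ i < k → v i k ≡ Y i k
  val-cell {i} {k} γ<k with k ≤ᵇ γ i | ≤ᵇ-reflects-≤ k (γ i)
  ... | .true | ofʸ k≤γ = contradiction γ<k (≤⇒≯ k≤γ)
  ... | .false | ofⁿ _ = refl

  val-basement : ∀ {i k} → k ≤ γ i → v i k ≡ b i
  val-basement {i} {k} k≤γ with k ≤ᵇ γ i | ≤ᵇ-reflects-≤ k (γ i)
  ... | .true | ofʸ _ = refl
  ... | .false | ofⁿ k≰γ = contradiction k≤γ k≰γ

  val-entry : ∀ {k i x} → Entry k i x → v i k ≡ x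
  val-entry ((γ<k , _) , Y≡x) = trans (val-cell γ<k) Y≡x

  column-injective : ∀ {k i i' x} → i Fin.< i' → Entry k i x → Entry k i' x → ⊥
  column-injective {k} {i} {i'} i<i' e@((γ<k , k≤δ) , _) e'@((_ , k≤δ') , _) with δ i' ≤? δ i
  ... | yes δ'≤δ = inversion-a≢b (typeA i i' k i<i' (≤-trans (s≤s z≤n) γ<k) δ'≤δ k≤δ') same
    where same = trans (val-entry e) (sym (val-entry e'))
  ... | no δ'≰δ = inversion-b≢c (typeB i i' k i<i' δ<δ' (<-≤-trans (s≤s k≤δ) δ<δ') k≤δ) same
    where same = trans (val-entry e) (sym (val-entry e'))
          δ<δ' = ≰⇒> δ'≰δ

  no-repeat-lower-right : ∀ {k i p x} → i Fin.< p → Entry k i x → Entry (suc k) p x → ⊥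
  no-repeat-lower-right {k} {i} {p} i<p e@((_ , k≤δ) , _) e'@((_ , k+1≤δp) , _) with δ p ≤? δ i
  ... | yes δp≤δ = inversion-b≢c (typeA i p (suc k) i<p (s≤s z≤n) δp≤δ k+1≤δp) same
    where same = trans (val-entry e') (sym (val-entry e))
  ... | no δp≰δ = inversion-a≢b (typeB i p k i<p (≰⇒> δp≰δ) k+1≤δp k≤δ) same
    where same = trans (val-entry e') (sym (val-entry e))

  ascent-typeA : ∀ {k i i' m} → i Fin.< i' → δ i' ≤ δ i → Entry k i m → Entry k i' (suc m) → Entry (k ∸ 1) i m
  ascent-typeA {k} {i} {i'} {m} i<i' δ'≤δ em@((γ<k , k≤δ) , _) em'@((γ'<k , k≤δ') , Y'≡m+1) =
    (γ<k-1 , ≤-trans (m∸n≤m k 1) k≤δ) , trans (sym (val-cell γ<k-1)) left≡m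
    where
      left≡m : v i (k ∸ 1) ≡ m
      left≡m = inversion-ascent (subst₂ (λ x y → InversionTriple x y (v i (k ∸ 1))) (val-entry em) (val-entry em')
        (typeA i i' k i<i' (≤-trans (s≤s z≤n) γ<k) δ'≤δ k≤δ'))
      m<b : m < b i
      m<b = <-trans (<-≤-trans (subst (m <_) (sym Y'≡m+1) (n<1+n m)) (proj₂ (bounded i' k γ'<k k≤δ')))
                    (basement-large i)
      γ<k-1 : γ i < k ∸ 1
      γ<k-1 with γ i <? k ∸ 1
      ... | yes γ<k-1 = γ<k-1
      ... | no γ≮k-1 = contradiction (trans (sym (val-basement (≮⇒≥ γ≮k-1))) left≡m) (>⇒≢ m<b)

  ascent-typeB : ∀ {k i i' m} → i Fin.< i' → δ i < δ i' → Entry k i m → Entry k i' (suc m) →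
                 Entry (suc k) i' (suc m)
  ascent-typeB {k} {i} {i'} i<i' δ<δ' em@((_ , k≤δ) , _) em'@((γ'<k , _) , _) =
    (γ'<k+1 , k+1≤δ') , trans (sym (val-cell γ'<k+1)) (inversion-descent
      (subst₂ (InversionTriple (v i' (suc k))) (val-entry em) (val-entry em') (typeB i i' k i<i' δ<δ' k+1≤δ' k≤δ)))
    where
      γ'<k+1 = m≤n⇒m≤1+n γ'<k
      k+1≤δ' = <-≤-trans (s≤s k≤δ) δ<δ'

  private
    C : ℕ → List ℕ
    C = column δ γ b Y

    module Col (k : ℕ) = Selection (λ i → (γ i <ᵇ k) ∧ (k ≤ᵇ δ i)) (λ i → Y i k)

    selects⇒entry : ∀ {k i x} → Col.Selects k i x → Entry k i x
    selects⇒entry (inCol , Y≡x) =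
      let γ<k , k≤δ = Equivalence.to T-∧ inCol in (<ᵇ⇒< _ _ γ<k , ≤ᵇ⇒≤ _ _ k≤δ) , Y≡x

    cell⇒selected : ∀ {k i} → Cell i k → T ((γ i <ᵇ k) ∧ (k ≤ᵇ δ i))
    cell⇒selected (γ<k , k≤δ) = Equivalence.from T-∧ (<⇒<ᵇ γ<k , ≤⇒≤ᵇ k≤δ)

  column-occurs⁺ : ∀ {k i x} → Entry k i x → 1 ≤ count x (C k)
  column-occurs⁺ {k} {i} (cell , refl) = Col.selected-occurs⁺ k i (cell⇒selected cell)

  column-occurs⁻ : ∀ {k x} → 1 ≤ count x (C k) → Σ (Fin n) λ i → Entry k i x
  column-occurs⁻ {k} {x} occ = let i , sel = Col.selected-occurs⁻ k x occ in i , selects⇒entry sel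

  column-precedes : ∀ {k x y} → Precedes x y (C k) →
                    Σ (Fin n) λ i → Σ (Fin n) λ i' → i Fin.< i' × Entry k i x × Entry k i' y
  column-precedes {k} {x} {y} prec =
    let i , i' , i<i' , selx , sely = Col.selected-precedes k x y prec
    in i , i' , i<i' , selects⇒entry selx , selects⇒entry sely

  column-distinct : ∀ k → Distinct (C k)
  column-distinct k x with 2 ≤? count x (C k)
  ... | no ≱2 = ≤-pred (≰⇒> ≱2)
  ... | yes twice = let _ , _ , i<i' , e , e' = column-precedes (two-occurrences⇒precedes x (C k) twice)
                    in ⊥-elim (column-injective i<i' e e')

  column-count-entry : ∀ {k i x} → Entry k i x → count x (C k) ≡ 1
  column-count-entry {k} {x = x} entry = ≤-antisym (column-distinct k x) (column-occurs⁺ entry)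

  module RightCounts (t : ℕ) (δ≤t : ∀ i → δ i ≤ t) where
    open ColumnReading C t

    countRightOf-entry : ∀ {k i x} → k < t → Entry (suc k) i x → countRightOf k x ≡ countRightOf (suc k) x + 1
    countRightOf-entry {k} {x = x} k<t entry =
      trans (countRightOf-step k k<t x) (cong (countRightOf (suc k) x +_) (column-count-entry entry))

    column-count-forced : ∀ {k} x y → k < t → countRightOf (suc k) y ≤ countRightOf (suc k) x →
                          countRightOf k x ≤ countRightOf k y → count x (C (suc k)) ≤ count y (C (suc k))
    column-count-forced {k} x y k<t right≤ ≤here = +-cancelˡ-≤ (countRightOf (suc k) x) _ _ (begin
      countRightOf (suc k) x + count x (C (suc k)) ≡⟨ sym (countRightOf-step k k<t x) ⟩
      countRightOf k x                             ≤⟨ ≤here ⟩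
      countRightOf k y                             ≡⟨ countRightOf-step k k<t y ⟩
      countRightOf (suc k) y + count y (C (suc k)) ≤⟨ +-monoˡ-≤ (count y (C (suc k))) right≤ ⟩
      countRightOf (suc k) x + count y (C (suc k)) ∎)
      where open ≤-Reasoning

    module _ (m : ℕ) (increasing : ∀ k → k ≤ t → countRightOf k m ≤ countRightOf k (suc m)) where

      Tie : ℕ → Fin n → Fin n → Set
      Tie k i i' = i Fin.< i' × Entry k i m × Entry k i' (suc m) × countRightOf k (suc m) ≤ countRightOf k m

      tie-step : ∀ {k i i'} → k < t → Entry (suc k) i m → Entry (suc k) i' (suc m) →
                 countRightOf k (suc m) ≤ countRightOf k m ⇔ countRightOf (suc k) (suc m) ≤ countRightOf (suc k) m
      tie-step k<t em em' = mk⇔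
        (λ tie → +-cancelʳ-≤ 1 _ _ (subst₂ _≤_ (countRightOf-entry k<t em') (countRightOf-entry k<t em) tie))
        (λ tie → subst₂ _≤_ (sym (countRightOf-entry k<t em')) (sym (countRightOf-entry k<t em)) (+-monoˡ-≤ 1 tie))

      tie-leftward : ∀ {k i i'} → Tie (suc (suc k)) i i' → δ i' ≤ δ i →
                     Σ (Fin n) λ p → Tie (suc k) i p × δ p ≤ δ i
      tie-leftward {k} {i} {i'} (i<i' , em , em' , tie) δ'≤δ = p , (i<p , em-left , ep , tie-left) , δp≤δ
        where
          k+1<t = ≤-trans (proj₂ (proj₁ em)) (δ≤t i)
          em-left = ascent-typeA i<i' δ'≤δ em em'
          tie-left = Equivalence.from (tie-step k+1<t em em') tie
          successor-occurs : 1 ≤ count (suc m) (C (suc k))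
          successor-occurs = ≤-trans (column-occurs⁺ em-left)
            (column-count-forced m (suc m) (<⇒≤ k+1<t) tie-left (increasing k (≤-trans (n≤1+n k) (<⇒≤ k+1<t))))
          p = proj₁ (column-occurs⁻ successor-occurs)
          ep = proj₂ (column-occurs⁻ successor-occurs)
          i'≤p : toℕ i' ≤ toℕ p
          i'≤p = ≮⇒≥ λ p<i' → no-repeat-lower-right p<i' ep em'
          i<p = <-≤-trans i<i' i'≤p
          δp≤δ : δ p ≤ δ i
          δp≤δ with δ p ≤? δ i
          ... | yes δp≤δ = δp≤δ
          ... | no δp≰δ with m≤n⇒m<n∨m≡n i'≤p
          ...   | inj₂ i'≡p = contradiction (subst (λ q → δ q ≤ δ i) (Finₚ.toℕ-injective i'≡p) δ'≤δ) δp≰δ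
          ...   | inj₁ i'<p = ⊥-elim (column-injective i'<p em' (ascent-typeB i<p (≰⇒> δp≰δ) em-left ep))

      tie-rightward : ∀ {k i i'} → Tie k i i' → δ i < δ i' → k < t × Σ (Fin n) λ p → Tie (suc k) p i'
      tie-rightward {k} {i} {i'} (i<i' , em , em' , tie) δ<δ' = k<t , p , (p<i' , ep , em'-right , tie-right)
        where
          em'-right = ascent-typeB i<i' δ<δ' em em'
          k<t = ≤-trans (proj₂ (proj₁ em'-right)) (δ≤t i')
          predecessor-occurs : 1 ≤ count m (C (suc k))
          predecessor-occurs = ≤-trans (column-occurs⁺ em'-right)
            (column-count-forced (suc m) m k<t (increasing (suc k) k<t) tie)
          p = proj₁ (column-occurs⁻ predecessor-occurs)
          ep = proj₂ (column-occurs⁻ predecessor-occurs)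
          tie-right = Equivalence.to (tie-step k<t ep em'-right) tie
          p<i' = ≤-<-trans (≮⇒≥ λ i<p → no-repeat-lower-right i<p em ep) i<i'

      no-tie-typeA : ∀ k {i i'} → Tie k i i' → δ i' ≤ δ i → ⊥
      no-tie-typeA zero (_ , ((() , _) , _) , _) _
      no-tie-typeA (suc zero) (i<i' , em , em' , _) δ'≤δ with ascent-typeA i<i' δ'≤δ em em'
      ... | (() , _) , _
      no-tie-typeA (suc (suc k)) tie δ'≤δ =
        let _ , tie' , δp≤δ = tie-leftward tie δ'≤δ in no-tie-typeA (suc k) tie' δp≤δ

      no-tie-typeB : ∀ fuel k {i i'} → t ≤ fuel + k → Tie k i i' → δ i < δ i' → ⊥
      no-tie-typeB zero k t≤k tie δ<δ' = <⇒≱ (proj₁ (tie-rightward tie δ<δ')) t≤k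
      no-tie-typeB (suc fuel) k {i' = i'} t≤fuel+k tie δ<δ' with tie-rightward tie δ<δ'
      ... | _ , p , tie' with δ i' ≤? δ p
      ...   | yes δ'≤δp = no-tie-typeA (suc k) tie' δ'≤δp
      ...   | no δ'≰δp = no-tie-typeB fuel (suc k) (subst (t ≤_) (sym (+-suc fuel k)) t≤fuel+k) tie' (≰⇒> δ'≰δp)

      no-tie : ∀ k {i i'} → ¬ Tie k i i'
      no-tie k {i} {i'} tie with δ i' ≤? δ i
      ... | yes δ'≤δ = no-tie-typeA k tie δ'≤δ
      ... | no δ'≰δ = no-tie-typeB t k (m≤m+n t k) tie (≰⇒> δ'≰δ)

      ascent-strict : ∀ {k i i'} → i Fin.< i' → Entry k i m → Entry k i' (suc m) →
                      countRightOf k m < countRightOf k (suc m)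
      ascent-strict {k} i<i' em em' with countRightOf k m <? countRightOf k (suc m)
      ... | yes strict = strict
      ... | no ≮ = ⊥-elim (no-tie k (i<i' , em , em' , ≮⇒≥ ≮))

    column-ascents-strict : ∀ {R} → (∀ k → k ≤ t → IncreasingUpTo R (countRightOf k)) →
                            ∀ k → AscentsStrict R (countRightOf k) (C k)
    column-ascents-strict boundaries k (suc m) 2≤j j≤R prec =
      let _ , _ , i<i' , em , em' = column-precedes prec
      in ascent-strict m (λ k' k'≤t → boundaries k' k'≤t (suc m) 2≤j j≤R) i<i' em em'

numCols-bound : ∀ {n} (δ γ : Comp n) b Y i → δ i ≤ numCols δ γ b Y
numCols-bound {n} δ γ b Y i = ∈⇒≤maxList (map δ (allFin n)) (∈-map⁺ δ (∈-allFin i))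

proposition3p1 : (n : ℕ) → 1 ≤ n → (δ γ : Comp n) → γ ⊆ᶜ δ →
  (b : Fin n → ℕ) → (∀ k → n < b k) → (Y : Filling n) →
  IsSSK δ γ b Y → EntriesIn n δ γ Y →
  (IsContreLattice δ γ b Y ⇔ IsLooselyContreLattice δ γ b Y)
proposition3p1 n _ δ γ _ b basement-large Y ssk bounded =
  mk⇔ (contreLattice-transfer columns sets t (λ k x → sym (same k x)) sets-distinct
         (λ _ k → decreasing-ascentsStrict (sets k) (sortDec-deduplicate-decreasing (columns k) (column-distinct k))))
      (contreLattice-transfer sets columns t same column-distinct column-ascents-strict)
  where
    open Skyline δ γ b Y ssk bounded basement-large
    t = numCols δ γ b Y
    open RightCounts t (numCols-bound δ γ b Y)
    columns = column δ γ b Y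
    sets = columnSet δ γ b Y
    same : ∀ k x → count x (sets k) ≡ count x (columns k)
    same k x = count-↭ x (sortDec-deduplicate-↭ (columns k) (column-distinct k))
    sets-distinct : ∀ k → Distinct (sets k)
    sets-distinct k x = subst (_≤ 1) (sym (same k x)) (column-distinct k x)
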